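{- Let $k\geq 2$ and let $G=H\times K$ be a finite group. If $H$ and $K$ are both $k$-rotational, then $G$ is $k$-rotational.
   Context: For a finite group $X$ let $X^*=X\setminus\{1\}$. A partition of a set is a collection of non-empty pairwise disjoint subsets whose union is the set. $X$ is $k$-rotational if there exist $\sigma\in\mathrm{Aut}(X)$ and $S\subseteq X^*$ with $S^{ -1}=S$ such that $\{S,S^{\sigma},\dots,S^{\sigma^{k-1}}\}$ is a partition of $X^*$ (the $k$ sets pairwise disjoint and non-empty). -}

module Defs where

open import Data.Nat using (ℕ; zero; suc; _*_)
open import Data.Fin using (Fin)
open import Data.Fin.Properties using (*↔×)
open import Data.Product using (Σ; ∃; ∃-syntax; _×_; _,_; proj₁; proj₂)
open import Data.Product.Properties using (×-≡,≡→≡)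
open import Data.Product.Function.NonDependent.Propositional using (_×-↔_)
open import Function using (_∘_; _↔_; Inverse; Injective)
open import Function.Properties.Inverse using (↔-sym; ↔-trans)
open import Relation.Nullary using (¬_)
open import Relation.Binary.PropositionalEquality
  using (_≡_; refl; cong; cong₂; isEquivalence; sym; trans)
open import Algebra.Structures using (IsGroup)
open import Algebra.Definitions using (Congruent₂)

record FinGroup : Set₁ where
  field
    Carrier : Set
    _∙_     : Carrier → Carrier → Carrier
    ε       : Carrier
    _⁻¹     : Carrier → Carrier
    isGroup : IsGroup _≡_ _∙_ ε _⁻¹
    order   : ℕ
    enum    : Carrier ↔ Fin order
  infixl 7 _∙_
  infix 8 _⁻¹
  open IsGroup isGroup public
    using (assoc; identityˡ; identityʳ; inverseˡ; inverseʳ)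

_⊗_ : FinGroup → FinGroup → FinGroup
H ⊗ K = record
  { Carrier = H.Carrier × K.Carrier
  ; _∙_     = mul
  ; ε       = (H.ε , K.ε)
  ; _⁻¹     = inv
  ; isGroup = record
    { isMonoid = record
      { isSemigroup = record
        { isMagma = record
          { isEquivalence = isEquivalence
          ; ∙-cong = λ p q → cong₂ mul p q
          }
        ; assoc = λ { (a , b) (c , d) (e , f) →
                    ×-≡,≡→≡ (H.assoc a c e , K.assoc b d f) }
        }
      ; identity = (λ { (a , b) → ×-≡,≡→≡ (H.identityˡ a , K.identityˡ b) })
                 , (λ { (a , b) → ×-≡,≡→≡ (H.identityʳ a , K.identityʳ b) })
      }
    ; inverse = (λ { (a , b) → ×-≡,≡→≡ (H.inverseˡ a , K.inverseˡ b) })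
              , (λ { (a , b) → ×-≡,≡→≡ (H.inverseʳ a , K.inverseʳ b) })
    ; ⁻¹-cong = cong inv
    }
  ; order   = H.order * K.order
  ; enum    = ↔-trans (H.enum ×-↔ K.enum) (↔-sym *↔×)
  }
  where
    module H = FinGroup H
    module K = FinGroup K
    mul : H.Carrier × K.Carrier → H.Carrier × K.Carrier → H.Carrier × K.Carrier
    mul (a , b) (c , d) = (a H.∙ c , b K.∙ d)
    inv : H.Carrier × K.Carrier → H.Carrier × K.Carrier
    inv (a , b) = (a H.⁻¹ , b K.⁻¹)

module _ (X : FinGroup) where
  open FinGroup X

  record Aut : Set where
    field
      bij : Carrier ↔ Carrier
    map : Carrier → Carrier
    map = Inverse.to bij
    field
      hom : ∀ x y → map (x ∙ y) ≡ map x ∙ map y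

  Subset : Set₁
  Subset = Carrier → Set

  iter : (Carrier → Carrier) → ℕ → Carrier → Carrier
  iter f zero    x = x
  iter f (suc n) x = f (iter f n x)

  image^ : Aut → Subset → ℕ → Subset
  image^ σ S i x = ∃[ s ] (S s × iter (Aut.map σ) i s ≡ x)

  Rotational : ℕ → Set₁
  Rotational k = Σ Aut λ σ → Σ Subset λ S →
      (∀ x → S x → ¬ x ≡ ε)
    × (∀ x → S x → S (x ⁻¹))
    × (∀ x → S (x ⁻¹) → S x)
    × (∀ (i : Fin k) → ∃[ x ] image^ σ S (Data.Fin.toℕ i) x)
    × (∀ (i j : Fin k) x → image^ σ S (Data.Fin.toℕ i) x
                         → image^ σ S (Data.Fin.toℕ j) x → i ≡ j)
    × (∀ x → ¬ x ≡ ε → ∃[ i ] image^ σ S (Data.Fin.toℕ {k} i) x)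

{-# OPTIONS --safe #-}
module Submission where

-- Take ρ = σ × τ and U = (S × K) ∪ ({1} × T).  Since σ, τ are automorphisms,
-- U^(ρ^i) = (S^(σ^i) × K) ∪ ({1} × T^(τ^i)); the first parts partition
-- H* × K, the second ones {1} × K*, and the two kinds never meet because
-- 1 ∉ S^(σ^i).

open import Defs
open import Algebra.Bundles using (Group)
import Algebra.Properties.Group as GroupProperties
open import Data.Nat using (ℕ; _≥_; zero; suc)
open import Data.Fin using (toℕ)
open import Data.Fin.Properties using (inj⇒≟)
open import Data.Product using (∃-syntax; _×_; _,_; proj₁; proj₂)
import Data.Product as Product
open import Data.Product.Properties using (,-injective)
open import Data.Product.Function.NonDependent.Propositional using (_×-↔_)
open import Data.Sum using (_⊎_; inj₁; inj₂)
open import Function using (Inverse; Injection; Injective)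
open import Function.Properties.Inverse using (↔⇒↣)
open import Relation.Binary.Definitions using (DecidableEquality)
open import Relation.Nullary using (¬_; yes; no; contradiction)
open import Relation.Binary.PropositionalEquality
  using (_≡_; refl; sym; trans; cong; cong₂)

module FinGroupProperties (X : FinGroup) where
  open FinGroup X

  group : Group _ _
  group = record { isGroup = isGroup }

  open GroupProperties group public using (ε⁻¹≈ε; ⁻¹-injective; identityˡ-unique)

  _≟_ : DecidableEquality Carrier
  _≟_ = inj⇒≟ (↔⇒↣ enum)

  x⁻¹≡ε⇒x≡ε : ∀ {x} → x ⁻¹ ≡ ε → x ≡ ε
  x⁻¹≡ε⇒x≡ε x⁻¹≡ε = ⁻¹-injective (trans x⁻¹≡ε (sym ε⁻¹≈ε))

  iter-fixed : ∀ {f a} → f a ≡ a → ∀ i → iter X f i a ≡ a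
  iter-fixed         fa≡a zero    = refl
  iter-fixed {f} fa≡a (suc i) = trans (cong f (iter-fixed fa≡a i)) fa≡a

  iter-injective : ∀ {f} → Injective _≡_ _≡_ f → ∀ i → Injective _≡_ _≡_ (iter X f i)
  iter-injective f-inj zero    eq = eq
  iter-injective f-inj (suc i) eq = iter-injective f-inj i (f-inj eq)

  iter-surjective : ∀ {f} → (∀ y → ∃[ x ] f x ≡ y) → ∀ i y → ∃[ x ] iter X f i x ≡ y
  iter-surjective         f-surj zero    y = y , refl
  iter-surjective {f} f-surj (suc i) y with f-surj y
  ... | z , fz≡y with iter-surjective f-surj i z
  ...   | x , fⁱx≡z = x , trans (cong f fⁱx≡z) fz≡y

  module _ (σ : Aut X) where
    open Aut σ using (bij; map; hom)

    map-ε : map ε ≡ ε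
    map-ε = identityˡ-unique (map ε) (map ε)
              (trans (sym (hom ε ε)) (cong map (identityˡ ε)))

    map-injective : Injective _≡_ _≡_ map
    map-injective = Injection.injective (↔⇒↣ bij)

    map-surjective : ∀ y → ∃[ x ] map x ≡ y
    map-surjective y = Inverse.from bij y , Inverse.strictlyInverseˡ bij y

    image^-ε-free : ∀ {S} → (∀ x → S x → ¬ x ≡ ε) → ∀ i → ¬ image^ X σ S i ε
    image^-ε-free S-ε-free i (s , Ss , σⁱs≡ε) =
      S-ε-free s Ss
        (iter-injective map-injective i (trans σⁱs≡ε (sym (iter-fixed map-ε i))))

_×-aut_ : ∀ {H K} → Aut H → Aut K → Aut (H ⊗ K)
σ ×-aut τ = record
  { bij = Aut.bij σ ×-↔ Aut.bij τ
  ; hom = λ { (a , b) (c , d) → cong₂ _,_ (Aut.hom σ a c) (Aut.hom τ b d) }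
  }

iter-⊗ : ∀ {H K} f g i a b →
         iter (H ⊗ K) (Product.map f g) i (a , b) ≡ (iter H f i a , iter K g i b)
iter-⊗ f g zero    a b = refl
iter-⊗ f g (suc i) a b = cong (Product.map f g) (iter-⊗ f g i a b)

module _ {H K : FinGroup} where
  private
    module H where
      open FinGroup H public
      open FinGroupProperties H public
    module K where
      open FinGroup K public
      open FinGroupProperties K public

  _⊗ˢ_ : Subset H → Subset K → Subset (H ⊗ K)
  (S ⊗ˢ T) (h , y) = S h ⊎ (h ≡ H.ε × T y)

  ⊗ˢ-ε-free : ∀ {S T} → (∀ x → S x → ¬ x ≡ H.ε) → (∀ y → T y → ¬ y ≡ K.ε) →
              ∀ z → (S ⊗ˢ T) z → ¬ z ≡ FinGroup.ε (H ⊗ K)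
  ⊗ˢ-ε-free S-ε-free _ (h , y) (inj₁ Sh)      z≡ε = S-ε-free h Sh (cong proj₁ z≡ε)
  ⊗ˢ-ε-free _ T-ε-free (h , y) (inj₂ (_ , Ty)) z≡ε = T-ε-free y Ty (cong proj₂ z≡ε)

  ⊗ˢ-⁻¹-closed : ∀ {S T} → (∀ x → S x → S (x H.⁻¹)) → (∀ y → T y → T (y K.⁻¹)) →
                 ∀ z → (S ⊗ˢ T) z → (S ⊗ˢ T) (FinGroup._⁻¹ (H ⊗ K) z)
  ⊗ˢ-⁻¹-closed S-inv _ (h , y) (inj₁ Sh)         = inj₁ (S-inv h Sh)
  ⊗ˢ-⁻¹-closed _ T-inv (h , y) (inj₂ (refl , Ty)) = inj₂ (H.ε⁻¹≈ε , T-inv y Ty)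

  ⊗ˢ-⁻¹-closed′ : ∀ {S T} → (∀ x → S (x H.⁻¹) → S x) → (∀ y → T (y K.⁻¹) → T y) →
                  ∀ z → (S ⊗ˢ T) (FinGroup._⁻¹ (H ⊗ K) z) → (S ⊗ˢ T) z
  ⊗ˢ-⁻¹-closed′ S-inv _ (h , y) (inj₁ Sh⁻¹)         = inj₁ (S-inv h Sh⁻¹)
  ⊗ˢ-⁻¹-closed′ _ T-inv (h , y) (inj₂ (h⁻¹≡ε , Ty⁻¹)) =
    inj₂ (H.x⁻¹≡ε⇒x≡ε h⁻¹≡ε , T-inv y Ty⁻¹)

  module _ (σ : Aut H) (τ : Aut K) (S : Subset H) (T : Subset K) where
    private
      ρ = σ ×-aut τ
      U = S ⊗ˢ T

      iterρ-split : ∀ i {s t h y} → iter (H ⊗ K) (Aut.map ρ) i (s , t) ≡ (h , y) →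
                    iter H (Aut.map σ) i s ≡ h × iter K (Aut.map τ) i t ≡ y
      iterρ-split i {s} {t} eq =
        ,-injective (trans (sym (iter-⊗ (Aut.map σ) (Aut.map τ) i s t)) eq)

    image^-⊗ˢ⁻ : ∀ i {h y} → image^ (H ⊗ K) ρ U i (h , y) →
                 image^ H σ S i h ⊎ (h ≡ H.ε × image^ K τ T i y)
    image^-⊗ˢ⁻ i ((s , t) , inj₁ Ss , eq) = inj₁ (s , Ss , proj₁ (iterρ-split i eq))
    image^-⊗ˢ⁻ i ((s , t) , inj₂ (refl , Tt) , eq) with iterρ-split i eq
    ... | σⁱε≡h , τⁱt≡y =
      inj₂ (trans (sym σⁱε≡h) (H.iter-fixed (H.map-ε σ) i) , t , Tt , τⁱt≡y)

    image^-⊗ˢ-left : ∀ i {h} y → image^ H σ S i h → image^ (H ⊗ K) ρ U i (h , y)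
    image^-⊗ˢ-left i y (s , Ss , σⁱs≡h) with K.iter-surjective (K.map-surjective τ) i y
    ... | t , τⁱt≡y =
      (s , t) , inj₁ Ss ,
      trans (iter-⊗ (Aut.map σ) (Aut.map τ) i s t) (cong₂ _,_ σⁱs≡h τⁱt≡y)

    image^-⊗ˢ-right : ∀ i {y} → image^ K τ T i y → image^ (H ⊗ K) ρ U i (H.ε , y)
    image^-⊗ˢ-right i (t , Tt , τⁱt≡y) =
      (H.ε , t) , inj₂ (refl , Tt) ,
      trans (iter-⊗ (Aut.map σ) (Aut.map τ) i H.ε t)
            (cong₂ _,_ (H.iter-fixed (H.map-ε σ) i) τⁱt≡y)

  rotational-⊗ : ∀ {k} → Rotational H k → Rotational K k → Rotational (H ⊗ K) k
  rotational-⊗ {k} (σ , S , S-ε-free , S-inv , S-inv′ , S-nonempty , S-disjoint , S-cover)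
                   (τ , T , T-ε-free , T-inv , T-inv′ , _ , T-disjoint , T-cover) =
    σ ×-aut τ , S ⊗ˢ T ,
    ⊗ˢ-ε-free S-ε-free T-ε-free ,
    ⊗ˢ-⁻¹-closed S-inv T-inv , ⊗ˢ-⁻¹-closed′ S-inv′ T-inv′ ,
    nonempty , disjoint , cover
    where
    ε∉Sσⁱ : ∀ i → ¬ image^ H σ S i H.ε
    ε∉Sσⁱ = H.image^-ε-free σ S-ε-free

    nonempty : ∀ i → ∃[ z ] image^ (H ⊗ K) (σ ×-aut τ) (S ⊗ˢ T) (toℕ i) z
    nonempty i with S-nonempty i
    ... | h , h∈Sσⁱ = (h , K.ε) , image^-⊗ˢ-left σ τ S T (toℕ i) K.ε h∈Sσⁱ

    disjoint : ∀ i j z → image^ (H ⊗ K) (σ ×-aut τ) (S ⊗ˢ T) (toℕ i) z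
                       → image^ (H ⊗ K) (σ ×-aut τ) (S ⊗ˢ T) (toℕ j) z → i ≡ j
    disjoint i j (h , y) z∈Uρⁱ z∈Uρʲ
      with image^-⊗ˢ⁻ σ τ S T (toℕ i) z∈Uρⁱ | image^-⊗ˢ⁻ σ τ S T (toℕ j) z∈Uρʲ
    ... | inj₁ h∈Sσⁱ       | inj₁ h∈Sσʲ       = S-disjoint i j h h∈Sσⁱ h∈Sσʲ
    ... | inj₂ (_ , y∈Tτⁱ) | inj₂ (_ , y∈Tτʲ) = T-disjoint i j y y∈Tτⁱ y∈Tτʲ
    ... | inj₁ h∈Sσⁱ       | inj₂ (refl , _)  = contradiction h∈Sσⁱ (ε∉Sσⁱ (toℕ i))
    ... | inj₂ (refl , _)  | inj₁ h∈Sσʲ       = contradiction h∈Sσʲ (ε∉Sσⁱ (toℕ j))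

    cover : ∀ z → ¬ z ≡ FinGroup.ε (H ⊗ K) →
            ∃[ i ] image^ (H ⊗ K) (σ ×-aut τ) (S ⊗ˢ T) (toℕ {k} i) z
    cover (h , y) z≢ε with h H.≟ H.ε | y K.≟ K.ε
    ... | yes refl | yes refl = contradiction refl z≢ε
    ... | yes refl | no y≢ε with T-cover y y≢ε
    ...   | i , y∈Tτⁱ = i , image^-⊗ˢ-right σ τ S T (toℕ i) y∈Tτⁱ
    cover (h , y) z≢ε | no h≢ε | _ with S-cover h h≢ε
    ...   | i , h∈Sσⁱ = i , image^-⊗ˢ-left σ τ S T (toℕ i) y h∈Sσⁱ

lemma3p3 : (k : ℕ) → k ≥ 2 → (H K : FinGroup) →
    Rotational H k → Rotational K k → Rotational (H ⊗ K) k
lemma3p3 k _ H K = rotational-⊗
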